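{- Let $k\ge2$ and let $M$ be a strong $k$-chromatic-choosable graph. Then for every integer $m\ge k$, $$P_\ell(M,m) \ge m \max_{v\in V(M)} P_\ell(M-\{v\}, m-1) \ge m.$$
   Context: List assignments: each vertex $v$ gets a color set $L(v)$; an $m$-assignment has all lists of size $m$; a proper $L$-coloring is a proper coloring $f$ with $f(v)\in L(v)$. A list assignment is constant if all lists are equal. $G$ is strong $k$-chromatic-choosable if $\chi(G)=k$ and every $(k-1)$-assignment $L$ for which $G$ has no proper $L$-coloring is constant. $P_\ell(G,m)$ is the minimum, over all $m$-assignments $L$ for $G$, of the number of proper $L$-colorings of $G$. -}

module Defs where

open import Data.Nat using (ℕ; zero; suc; _≤_; _∸_; _*_)
open import Data.Nat.Properties using (_≟_)
open import Data.Fin using (Fin; zero; suc; punchIn)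
open import Data.Fin.Properties using (all?)
open import Data.Bool using (Bool; true; false; T)
open import Data.Bool.Properties using (T?)
open import Data.List using (List; []; _∷_; map; concatMap; length; filter)
open import Data.List.Membership.Propositional using (_∈_)
open import Data.List.Relation.Unary.Unique.Propositional using (Unique)
open import Data.Product using (Σ; _×_; _,_)
open import Function.Bundles using (_⇔_)
open import Relation.Binary.PropositionalEquality using (_≡_; _≢_)
open import Relation.Nullary using (¬_; Dec)
open import Relation.Nullary.Decidable using (_→-dec_; ¬?)

record Graph (n : ℕ) : Set where
  field
    adj    : Fin n → Fin n → Bool
    sym    : ∀ i j → adj i j ≡ adj j i
    irrefl : ∀ i → adj i i ≡ false
open Graph public

delete : ∀ {n} → Graph (suc n) → Fin (suc n) → Graph n
delete G v = record
  { adj    = λ i j → adj G (punchIn v i) (punchIn v j)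
  ; sym    = λ i j → sym G (punchIn v i) (punchIn v j)
  ; irrefl = λ i → irrefl G (punchIn v i)
  }

Proper : ∀ {n} {C : Set} → Graph n → (Fin n → C) → Set
Proper G f = ∀ i j → T (adj G i j) → f i ≢ f j

ChromaticNumber : ∀ {n} → Graph n → ℕ → Set
ChromaticNumber {n} G k =
  Σ (Fin n → Fin k) (λ f → Proper G f)
  × (∀ (f : Fin n → Fin (k ∸ 1)) → ¬ Proper G f)

-- list assignments: colours are natural numbers, a list is a duplicate-free list
ListAssignment : ℕ → Set
ListAssignment n = Fin n → List ℕ

IsAssignment : ∀ {n} → ℕ → ListAssignment n → Set
IsAssignment m L = ∀ v → Unique (L v) × length (L v) ≡ m

Constant : ∀ {n} → ListAssignment n → Set
Constant L = ∀ u v x → (x ∈ L u) ⇔ (x ∈ L v)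

ProperLColoring : ∀ {n} → Graph n → ListAssignment n → (Fin n → ℕ) → Set
ProperLColoring G L f = Proper G f × (∀ v → f v ∈ L v)

StrongChromaticChoosable : ∀ {n} → ℕ → Graph n → Set
StrongChromaticChoosable {n} k G =
  ChromaticNumber G k
  × (∀ (L : ListAssignment n) → IsAssignment (k ∸ 1) L →
       ¬ Σ (Fin n → ℕ) (λ f → ProperLColoring G L f) → Constant L)

cons : ∀ {n} → ℕ → (Fin n → ℕ) → Fin (suc n) → ℕ
cons c g zero    = c
cons c g (suc i) = g i

choices : ∀ {n} → ListAssignment n → List (Fin n → ℕ)
choices {zero}  L = (λ ()) ∷ []
choices {suc n} L = concatMap (λ c → map (cons c) (choices (λ i → L (suc i)))) (L zero)

proper? : ∀ {n} (G : Graph n) (f : Fin n → ℕ) → Dec (Proper G f)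
proper? G f = all? (λ i → all? (λ j → T? (adj G i j) →-dec ¬? (f i ≟ f j)))

count : ∀ {n} → Graph n → ListAssignment n → ℕ
count G L = length (filter (proper? G) (choices L))

-- IsPl G m p : p = P_ℓ(G, m), the minimum over all m-assignments L of count G L
IsPl : ∀ {n} → Graph n → ℕ → ℕ → Set
IsPl {n} G m p =
  Σ (ListAssignment n) (λ L → IsAssignment m L × count G L ≡ p)
  × (∀ (L : ListAssignment n) → IsAssignment m L → p ≤ count G L)

-- For a colour c ∈ L(v), removing c from the other lists gives an (m−1)-assignment of M − v;
-- each of its proper colourings extends by c at v to a proper L-colouring of M, and different
-- choices of c or of the colouring give different colourings of M, so
-- count M L ≥ m · P_ℓ(M − v, m − 1). If instead some (m−1)-assignment L′ of M − v admitted
-- no colouring, shortening every list of L′ to k − 1 colours and giving v a list whose first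
-- colour is missing from the list of another vertex would be a non-constant (k−1)-assignment of M without a
-- colouring, contradicting strong k-chromatic-choosability; hence P_ℓ(M − v, m − 1) ≥ 1.
module Submission where

open import Defs
open import Data.Bool using (T)
open import Data.Fin using (Fin; zero; suc; punchIn)
open import Data.Fin.Properties using (punchIn-punchOut) renaming (_≟_ to _≟ᶠ_)
open import Data.List using (List; []; _∷_; map; concatMap; length; _++_; filter; take; applyUpTo)
open import Data.List.Properties using (length-removeAt′; length-++; length-map; length-take; length-applyUpTo)
open import Data.List.Extrema.Nat using (max; xs≤max)
open import Data.List.Membership.Propositional using (_∈_; _∉_)
open import Data.List.Membership.Propositional.Properties using (∈-filter⁺; ∈-filter⁻)
import Data.List.Membership.Setoid as SetoidMembership
import Data.List.Membership.Setoid.Properties as SetoidMembershipₚ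
open import Data.List.Relation.Binary.Disjoint.Setoid using (Disjoint)
import Data.List.Relation.Binary.Sublist.Propositional as Sublist
import Data.List.Relation.Binary.Sublist.Propositional.Properties as Sublist
open import Data.List.Relation.Unary.All as All using (All; []; _∷_)
import Data.List.Relation.Unary.All.Properties as All
open import Data.List.Relation.Unary.AllPairs as AllPairs using ([]; _∷_)
import Data.List.Relation.Unary.AllPairs.Properties as AllPairs
open import Data.List.Relation.Unary.Any as Any using (here; there; index)
import Data.List.Relation.Unary.Any.Properties as Any
open import Data.List.Relation.Unary.Unique.Propositional using (Unique)
import Data.List.Relation.Unary.Unique.Propositional.Properties as Unique
import Data.List.Relation.Unary.Unique.Setoid as UniqueSetoid
import Data.List.Relation.Unary.Unique.Setoid.Properties as UniqueSetoidₚ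
open import Data.Nat using (ℕ; zero; suc; _≤_; _<_; _*_; _+_; _∸_; _⊓_; z≤n; s≤s; _≤?_; >-nonZero)
open import Data.Nat.Properties
  using (_≟_; +-mono-≤; ≤-trans; ≤-reflexive; m≤n⇒m⊓n≡m; ∸-monoˡ-≤; 1+n≰n; <⇒≢; +-cancelʳ-≡;
         m≤m*n; module ≤-Reasoning)
open import Data.Empty using (⊥-elim)
open import Data.Product using (Σ; _×_; _,_; proj₁; proj₂)
open import Data.Vec.Functional using (insertAt)
open import Data.Vec.Functional.Properties using (insertAt-lookup; insertAt-punchIn)
open import Function using (_∘_)
open import Function.Bundles using (Equivalence)
open import Level using (Level)
open import Relation.Binary.Bundles using (Setoid)
open import Relation.Binary.PropositionalEquality as ≡ using (_≡_; _≢_; refl; _≗_; _→-setoid_)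
open import Relation.Nullary using (¬_; ¬?; yes; no)
open import Relation.Nullary.Decidable using (decidable-stable)

private
  variable
    a ℓ : Level

module _ (S : Setoid a ℓ) where
  open Setoid S renaming (Carrier to A; sym to ≈-sym; trans to ≈-trans)
  open SetoidMembership S using (_─_) renaming (_∈_ to _∈ₛ_)
  open UniqueSetoid S renaming (Unique to Uniqueₛ)

  ∈-─⁺ : ∀ {x y ys} (x∈ys : x ∈ₛ ys) → y ∈ₛ ys → ¬ y ≈ x → y ∈ₛ ys ─ x∈ys
  ∈-─⁺ (here x≈z)   (here y≈z)   y≉x = ⊥-elim (y≉x (≈-trans y≈z (≈-sym x≈z)))
  ∈-─⁺ (here _)     (there y∈ys) _   = y∈ys
  ∈-─⁺ (there _)    (here y≈z)   _   = here y≈z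
  ∈-─⁺ (there x∈ys) (there y∈ys) y≉x = there (∈-─⁺ x∈ys y∈ys y≉x)

  Unique⇒length≤ : ∀ {xs ys} → Uniqueₛ xs → All (_∈ₛ ys) xs → length xs ≤ length ys
  Unique⇒length≤ {[]}          _            _              = z≤n
  Unique⇒length≤ {x ∷ xs} {ys} (x≉xs ∷ xs!) (x∈ys ∷ xs⊆ys) = begin
    suc (length xs)          ≤⟨ s≤s (Unique⇒length≤ xs! xs⊆ys─x) ⟩
    suc (length (ys ─ x∈ys)) ≡⟨ length-removeAt′ ys (index x∈ys) ⟨
    length ys                ∎
    where
    open ≤-Reasoning
    xs⊆ys─x : All (_∈ₛ ys ─ x∈ys) xs
    xs⊆ys─x = All.zipWith (λ (y∈ys , x≉y) → ∈-─⁺ x∈ys y∈ys (x≉y ∘ ≈-sym)) (xs⊆ys , x≉xs)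

  concatMap-unique : ∀ {B : Set} {F : B → List A} (key : A → B) →
                     (∀ {x y} → x ≈ y → key x ≡ key y) →
                     (∀ b → All (λ y → key y ≡ b) (F b)) → (∀ b → Uniqueₛ (F b)) →
                     ∀ {bs} → Unique bs → Uniqueₛ (concatMap F bs)
  concatMap-unique {F = F} key key-cong keyed F! bs! =
    UniqueSetoidₚ.concat⁺ S (All.map⁺ (All.universal F! _)) (AllPairs.map⁺ (AllPairs.map disjoint bs!))
    where
    key-∈ : ∀ {y b} → y ∈ₛ F b → key y ≡ b
    key-∈ {y} {b} =
      All.lookupWith {R = λ _ → key y ≡ b} (λ kz≡b y≈z → ≡.trans (key-cong y≈z) kz≡b) (keyed b)
    disjoint : ∀ {b b′} → b ≢ b′ → Disjoint S (F b) (F b′)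
    disjoint b≢b′ (y∈Fb , y∈Fb′) = b≢b′ (≡.trans (≡.sym (key-∈ y∈Fb)) (key-∈ y∈Fb′))

length-concatMap-≥ : ∀ {A B : Set} (F : A → List B) {q} → (∀ x → q ≤ length (F x)) →
                     ∀ xs → length xs * q ≤ length (concatMap F xs)
length-concatMap-≥ F         q≤ []       = z≤n
length-concatMap-≥ F {q} q≤ (x ∷ xs) = begin
  q + length xs * q                      ≤⟨ +-mono-≤ (q≤ x) (length-concatMap-≥ F q≤ xs) ⟩
  length (F x) + length (concatMap F xs) ≡⟨ length-++ (F x) ⟨
  length (F x ++ concatMap F xs)         ∎
  where open ≤-Reasoning

∈-take⁻ : ∀ {x : ℕ} k xs → x ∈ take k xs → x ∈ xs
∈-take⁻ k xs = Sublist.lookup (Sublist.take-⊆ k xs)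

-- Removes c if present and the last colour otherwise, so that the list always shrinks by one.
removeColour : ℕ → List ℕ → List ℕ
removeColour c xs = take (length xs ∸ 1) (filter (λ x → ¬? (x ≟ c)) xs)

module _ (c : ℕ) {xs : List ℕ} where

  ∈-removeColour⁻ : ∀ {y} → y ∈ removeColour c xs → y ∈ xs × y ≢ c
  ∈-removeColour⁻ = ∈-filter⁻ _ ∘ ∈-take⁻ (length xs ∸ 1) _

  removeColour-unique : Unique xs → Unique (removeColour c xs)
  removeColour-unique = Unique.take⁺ _ ∘ Unique.filter⁺ _

  length-removeColour : Unique xs → length (removeColour c xs) ≡ length xs ∸ 1
  length-removeColour xs! =
    ≡.trans (length-take (length xs ∸ 1) others) (m≤n⇒m⊓n≡m (∸-monoˡ-≤ 1 xs≤1+others))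
    where
    others : List ℕ
    others = filter (λ x → ¬? (x ≟ c)) xs
    c∷others : ∀ {y} → y ∈ xs → y ∈ c ∷ others
    c∷others {y} y∈xs with y ≟ c
    ... | yes y≡c = here y≡c
    ... | no  y≢c = there (∈-filter⁺ _ y∈xs y≢c)
    xs≤1+others : length xs ≤ length (c ∷ others)
    xs≤1+others = Unique⇒length≤ (≡.setoid ℕ) xs! (All.tabulate c∷others)

removeColour-isAssignment : ∀ {n m} {L : ListAssignment n} → IsAssignment m L →
                            ∀ c → IsAssignment (m ∸ 1) (removeColour c ∘ L)
removeColour-isAssignment L-isA c u =
  removeColour-unique c (proj₁ (L-isA u)) ,
  ≡.trans (length-removeColour c (proj₁ (L-isA u))) (≡.cong (_∸ 1) (proj₂ (L-isA u)))

take-isAssignment : ∀ {n m k} {L : ListAssignment n} → IsAssignment m L → k ≤ m →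
                    IsAssignment k (take k ∘ L)
take-isAssignment {k = k} {L} L-isA k≤m u =
  Unique.take⁺ k (proj₁ (L-isA u)) ,
  ≡.trans (length-take k (L u)) (≡.trans (≡.cong (k ⊓_) (proj₂ (L-isA u))) (m≤n⇒m⊓n≡m k≤m))

-- Without function extensionality, colourings are compared pointwise.
ColouringSetoid : ℕ → Setoid _ _
ColouringSetoid n = Fin n →-setoid ℕ

module _ {n : ℕ} where
  open SetoidMembership (ColouringSetoid n) public using () renaming (_∈_ to _∈ᶜ_)
  open UniqueSetoid (ColouringSetoid n) public using () renaming (Unique to Uniqueᶜ)

choices-sound : ∀ {n} (L : ListAssignment n) → All (λ f → ∀ u → f u ∈ L u) (choices L)
choices-sound {zero}  L = (λ ()) ∷ []
choices-sound {suc n} L = All.concat⁺ (All.map⁺ (All.tabulate λ {c} c∈L₀ →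
  All.map⁺ (All.map (λ g∈ → λ { zero → c∈L₀ ; (suc i) → g∈ i }) (choices-sound (L ∘ suc)))))

∈-choices⁺ : ∀ {n} (L : ListAssignment n) {f : Fin n → ℕ} → (∀ u → f u ∈ L u) → f ∈ᶜ choices L
∈-choices⁺ {zero}  L     f∈ = here (λ ())
∈-choices⁺ {suc n} L {f} f∈ = SetoidMembershipₚ.∈-concatMap⁺ (≡.setoid ℕ) (ColouringSetoid (suc n))
  (Any.map (λ { refl → Any.map⁺ (Any.map extend (∈-choices⁺ (L ∘ suc) (f∈ ∘ suc))) }) (f∈ zero))
  where
  extend : ∀ {g} → f ∘ suc ≗ g → f ≗ cons (f zero) g
  extend f∘suc≗g zero    = refl
  extend f∘suc≗g (suc i) = f∘suc≗g i

choices-unique : ∀ {n} (L : ListAssignment n) → (∀ u → Unique (L u)) → Uniqueᶜ (choices L)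
choices-unique {zero}  L L! = [] ∷ []
choices-unique {suc n} L L! =
  concatMap-unique (ColouringSetoid (suc n)) (λ f → f zero) (λ f≗g → f≗g zero)
    (λ c → All.map⁺ (All.universal (λ _ → refl) _))
    (λ c → UniqueSetoidₚ.map⁺ (ColouringSetoid n) (ColouringSetoid (suc n)) (λ e i → e (suc i))
             (choices-unique (L ∘ suc) (L! ∘ suc)))
    (L! zero)

colourings : ∀ {n} → Graph n → ListAssignment n → List (Fin n → ℕ)
colourings G L = filter (proper? G) (choices L)

Proper-resp-≗ : ∀ {n} (G : Graph n) {f g : Fin n → ℕ} → f ≗ g → Proper G f → Proper G g
Proper-resp-≗ G f≗g pf i j i~j gi≡gj = pf i j i~j (≡.trans (f≗g i) (≡.trans gi≡gj (≡.sym (f≗g j))))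

colourings-sound : ∀ {n} (G : Graph n) (L : ListAssignment n) → All (ProperLColoring G L) (colourings G L)
colourings-sound G L =
  All.zip (All.all-filter (proper? G) (choices L) , All.filter⁺ (proper? G) (choices-sound L))

∈-colourings⁺ : ∀ {n} (G : Graph n) (L : ListAssignment n) {f : Fin n → ℕ} →
                ProperLColoring G L f → f ∈ᶜ colourings G L
∈-colourings⁺ G L (pf , f∈) =
  SetoidMembershipₚ.∈-filter⁺ (ColouringSetoid _) (proper? G) (Proper-resp-≗ G) (∈-choices⁺ L f∈) pf

colourings-unique : ∀ {n} (G : Graph n) (L : ListAssignment n) → (∀ u → Unique (L u)) →
                    Uniqueᶜ (colourings G L)
colourings-unique G L L! = UniqueSetoidₚ.filter⁺ (ColouringSetoid _) (proper? G) (choices-unique L L!)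

count-pos : ∀ {n} (G : Graph n) (L : ListAssignment n) {f : Fin n → ℕ} →
            ProperLColoring G L f → 1 ≤ count G L
count-pos G L f-col = SetoidMembershipₚ.∈-length (ColouringSetoid _) (∈-colourings⁺ G L f-col)

data PunchInView {n} (v : Fin (suc n)) : Fin (suc n) → Set where
  pivot   : PunchInView v v
  punched : (j : Fin n) → PunchInView v (punchIn v j)

punchInView : ∀ {n} (v u : Fin (suc n)) → PunchInView v u
punchInView v u with v ≟ᶠ u
... | yes refl = pivot
... | no  v≢u  = ≡.subst (PunchInView v) (punchIn-punchOut v≢u) (punched _)

module _ {n} (G : Graph (suc n)) (v : Fin (suc n)) {g : Fin n → ℕ} {c : ℕ} where

  insertAt-proper : Proper (delete G v) g → (∀ j → g j ≢ c) → Proper G (insertAt g v c)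
  insertAt-proper pg c-fresh i j i~j with punchInView v i | punchInView v j
  ... | pivot      | pivot      = ⊥-elim (≡.subst T (irrefl G v) i~j)
  ... | pivot      | punched j′
    rewrite insertAt-lookup g v c | insertAt-punchIn g v c j′ = c-fresh j′ ∘ ≡.sym
  ... | punched i′ | pivot
    rewrite insertAt-lookup g v c | insertAt-punchIn g v c i′ = c-fresh i′
  ... | punched i′ | punched j′
    rewrite insertAt-punchIn g v c i′ | insertAt-punchIn g v c j′ = pg i′ j′ i~j

  insertAt-∈ : ∀ {L : ListAssignment (suc n)} → c ∈ L v → (∀ j → g j ∈ L (punchIn v j)) →
               ∀ u → insertAt g v c u ∈ L u
  insertAt-∈ c∈ g∈ u with punchInView v u
  ... | pivot     rewrite insertAt-lookup g v c    = c∈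
  ... | punched j rewrite insertAt-punchIn g v c j = g∈ j

insertAt-injective : ∀ {n} (v : Fin (suc n)) (c : ℕ) {g g′ : Fin n → ℕ} →
                     insertAt g v c ≗ insertAt g′ v c → g ≗ g′
insertAt-injective v c {g} {g′} eq j =
  ≡.trans (≡.sym (insertAt-punchIn g v c j)) (≡.trans (eq (punchIn v j)) (insertAt-punchIn g′ v c j))

insertAt-isAssignment : ∀ {n m} {L : ListAssignment n} (v : Fin (suc n)) {xs : List ℕ} → IsAssignment m L →
                        Unique xs → length xs ≡ m → IsAssignment m (insertAt L v xs)
insertAt-isAssignment {L = L} v {xs} L-isA xs! |xs| u with punchInView v u
... | pivot     rewrite insertAt-lookup L v xs    = xs! , |xs|
... | punched j rewrite insertAt-punchIn L v xs j = L-isA j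

module _ {n} (G : Graph (suc n)) (v : Fin (suc n))
         {m} {L : ListAssignment (suc n)} (L-isA : IsAssignment m L) where

  avoiding : ℕ → ListAssignment n
  avoiding c = removeColour c ∘ L ∘ punchIn v

  avoiding-isA : ∀ c → IsAssignment (m ∸ 1) (avoiding c)
  avoiding-isA = removeColour-isAssignment (L-isA ∘ punchIn v)

  extensions : ℕ → List (Fin (suc n) → ℕ)
  extensions c = map (λ g → insertAt g v c) (colourings (delete G v) (avoiding c))

  extend-colouring : ∀ {c g} → c ∈ L v → ProperLColoring (delete G v) (avoiding c) g →
                     ProperLColoring G L (insertAt g v c)
  extend-colouring {c} c∈ (pg , g∈) =
    insertAt-proper G v pg (proj₂ ∘ g∈′) , insertAt-∈ G v c∈ (proj₁ ∘ g∈′)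
    where g∈′ = λ j → ∈-removeColour⁻ c (g∈ j)

  extensions-sound : All (_∈ᶜ colourings G L) (concatMap extensions (L v))
  extensions-sound = All.concat⁺ (All.map⁺ (All.tabulate λ {c} c∈ →
    All.map⁺ (All.map (∈-colourings⁺ G L ∘ extend-colouring c∈)
                       (colourings-sound (delete G v) (avoiding c)))))

  extensions-unique : Uniqueᶜ (concatMap extensions (L v))
  extensions-unique = concatMap-unique (ColouringSetoid (suc n)) (λ f → f v) (λ f≗g → f≗g v)
    (λ c → All.map⁺ (All.universal (λ g → insertAt-lookup g v c) _))
    (λ c → UniqueSetoidₚ.map⁺ (ColouringSetoid n) (ColouringSetoid (suc n)) (insertAt-injective v c)
             (colourings-unique (delete G v) (avoiding c) (proj₁ ∘ avoiding-isA c)))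
    (proj₁ (L-isA v))

  m*q≤count : ∀ {q} → (∀ L′ → IsAssignment (m ∸ 1) L′ → q ≤ count (delete G v) L′) →
              m * q ≤ count G L
  m*q≤count {q} q≤count = begin
    m * q                               ≡⟨ ≡.cong (_* q) (proj₂ (L-isA v)) ⟨
    length (L v) * q                    ≤⟨ length-concatMap-≥ extensions q≤extensions (L v) ⟩
    length (concatMap extensions (L v)) ≤⟨ Unique⇒length≤ (ColouringSetoid _)
                                            extensions-unique extensions-sound ⟩
    count G L                           ∎
    where
    open ≤-Reasoning
    q≤extensions : ∀ c → q ≤ length (extensions c)
    q≤extensions c = ≤-trans (q≤count (avoiding c) (avoiding-isA c))
                             (≤-reflexive (≡.sym (length-map _ (colourings (delete G v) (avoiding c)))))

module _ {n k m} (G : Graph (suc (suc n))) (k<m : suc k < m)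
         (strong : ∀ L → IsAssignment (suc k) L → ¬ Σ _ (ProperLColoring G L) → Constant L)
         (v : Fin (suc (suc n))) {L : ListAssignment (suc n)} (L-isA : IsAssignment (m ∸ 1) L) where

  private
    fresh : ℕ
    fresh = suc (max 0 (L zero))

    fresh∉L₀ : fresh ∉ L zero
    fresh∉L₀ fresh∈ = 1+n≰n (All.lookup (xs≤max 0 (L zero)) fresh∈)

    -- Only its first colour, fresh, matters: constancy would push it into the list of punchIn v zero.
    palette : List ℕ
    palette = applyUpTo (_+ fresh) (suc k)

    Lᵛ : ListAssignment (suc (suc n))
    Lᵛ = insertAt (take (suc k) ∘ L) v palette

    Lᵛ-isA : IsAssignment (suc k) Lᵛ
    Lᵛ-isA = insertAt-isAssignment v (take-isAssignment L-isA (∸-monoˡ-≤ 1 k<m))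
      (Unique.applyUpTo⁺₁ (_+ fresh) (suc k) (λ i<j _ → <⇒≢ i<j ∘ +-cancelʳ-≡ _ _ _))
      (length-applyUpTo (_+ fresh) (suc k))

    Lᵛ-punchIn : ∀ j → Lᵛ (punchIn v j) ≡ take (suc k) (L j)
    Lᵛ-punchIn = insertAt-punchIn (take (suc k) ∘ L) v palette

    restrict : Σ _ (ProperLColoring G Lᵛ) → 1 ≤ count (delete G v) L
    restrict (f , pf , f∈) = count-pos (delete G v) L
      ( (λ i j → pf (punchIn v i) (punchIn v j))
      , λ j → ∈-take⁻ (suc k) (L j)
                (≡.subst (f (punchIn v j) ∈_) (Lᵛ-punchIn j) (f∈ (punchIn v j))))

  delete-count-pos-suc : 1 ≤ count (delete G v) L
  delete-count-pos-suc = decidable-stable (1 ≤? count (delete G v) L) λ uncolourable →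
    let fresh∈Lᵛv     = ≡.subst (fresh ∈_) (≡.sym (insertAt-lookup _ v palette)) (here refl)
        Lᵛ-constant   = strong Lᵛ Lᵛ-isA (uncolourable ∘ restrict)
        fresh∈Lᵛ-next = Equivalence.to (Lᵛ-constant v (punchIn v zero) fresh) fresh∈Lᵛv
    in fresh∉L₀ (∈-take⁻ (suc k) (L zero) (≡.subst (fresh ∈_) (Lᵛ-punchIn zero) fresh∈Lᵛ-next))

delete-count-pos : ∀ {n k m} (G : Graph (suc n)) → suc k < m →
                   (∀ L → IsAssignment (suc k) L → ¬ Σ _ (ProperLColoring G L) → Constant L) →
                   ∀ v {L} → IsAssignment (m ∸ 1) L → 1 ≤ count (delete G v) L
delete-count-pos {zero}  G _   _      v {L} _ = count-pos (delete G v) L {f = λ ()} ((λ ()) , (λ ()))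
delete-count-pos {suc n} G k<m strong v   = delete-count-pos-suc G k<m strong v

theorem5p1 : ∀ {n} (k : ℕ) → 2 ≤ k → (M : Graph (suc n)) → StrongChromaticChoosable k M →
    ∀ (m : ℕ) → k ≤ m →
    ((v : Fin (suc n)) (q : ℕ) → IsPl (delete M v) (m ∸ 1) q →
       ∀ (L : ListAssignment (suc n)) → IsAssignment m L → m * q ≤ count M L)
    × Σ (Fin (suc n)) (λ v → ∀ (L : ListAssignment n) → IsAssignment (m ∸ 1) L →
       m ≤ m * count (delete M v) L)
theorem5p1 (suc (suc k)) (s≤s (s≤s z≤n)) M (_ , strong) m k≤m =
  (λ v q (_ , q≤count) L L-isA → m*q≤count M v L-isA q≤count) ,
  (zero , λ L L-isA → m≤m*n m _ {{>-nonZero (delete-count-pos M k≤m strong zero L-isA)}})
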